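{- Let $\mathbf v=(1,2,2^2,\dots,2^{n-1})\in\mathbb{R}^n$. Then the affine hyperplane $H_{\mathbf v}$ is generic with respect to the arrangement $\mathcal{B}_n$. Moreover, for all $(\omega,\epsilon)\in B_n$, $R_{\omega,\epsilon}\cap H_{\mathbf v}$ is nonempty and bounded if and only if all right-to-left maxima of $(\omega,\epsilon)$ are unbarred.
   Context: $\mathcal{B}_n$ is the arrangement in $\mathbb{R}^n$ of the hyperplanes $x_i=x_j$, $x_i=-x_j$ ($1\le i<j\le n$) and $x_i=0$ ($1\le i\le n$). $H_{\mathbf v}=\{\mathbf x:\mathbf v\cdot\mathbf x=\mathbf v\cdot\mathbf v\}$ is the affine hyperplane through $\mathbf v$ normal to $\mathbf v$. An affine hyperplane $H$ is generic with respect to an arrangement if $\dim(H\cap X)=\dim X-1$ for every intersection $X$ of a subfamily of its hyperplanes. $B_n$ is the set of signed permutations $(\omega,\epsilon)$, $\omega\in S_n$, $\epsilon\in\{ -1,1\}^n$, where $\omega(i)$ is called barred iff $\epsilon_i=-1$. $R_{\omega,\epsilon}=\{\mathbf x\in\mathbb{R}^n:0<\epsilon_1x_{\omega(1)}<\dots<\epsilon_nx_{\omega(n)}\}$. $\omega(i)$ is a right-to-left maximum of $(\omega,\epsilon)$ if $\omega(i)>\omega(j)$ for all $j>i$.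
   Formalization: Stated over ℚ^n instead of ℝ^n, so the regions $R_{\omega,\epsilon}$, the hyperplane $H_{\mathbf v}$ and the intersections of hyperplanes of $\mathcal{B}_n$ consist of their rational points only. -}

module Defs where

open import Data.Nat as ℕ using (ℕ; zero; suc; _^_)
open import Data.Fin using (Fin; zero; suc; toℕ)
import Data.Fin as Fin
open import Data.Integer as ℤ using (ℤ; +_; -[1+_])
open import Data.Rational using (ℚ; 0ℚ; _+_; _*_; -_; _<_; _≤_; ∣_∣; _/_)
open import Data.Sign using (Sign)
open import Data.Fin.Permutation using (Permutation′; _⟨$⟩ʳ_)
open import Data.Product using (Σ; ∃; _×_; _,_)
open import Data.Empty using (⊥)
open import Data.List using (List)
open import Data.List.Relation.Unary.All using (All)
open import Relation.Binary.PropositionalEquality using (_≡_)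
open import Relation.Nullary using (¬_)

Vecℚ : ℕ → Set
Vecℚ n = Fin n → ℚ

sumℚ : ∀ {n} → (Fin n → ℚ) → ℚ
sumℚ {zero}  f = 0ℚ
sumℚ {suc n} f = f zero + sumℚ (λ i → f (suc i))

_·_ : ∀ {n} → Vecℚ n → Vecℚ n → ℚ
x · y = sumℚ (λ i → x i * y i)

Subsetℚ : ℕ → Set₁
Subsetℚ n = Vecℚ n → Set

_∩_ : ∀ {n} → Subsetℚ n → Subsetℚ n → Subsetℚ n
(A ∩ B) x = A x × B x

H : ∀ {n} → Vecℚ n → Subsetℚ n
H v x = v · x ≡ v · v

vPow2 : (n : ℕ) → Vecℚ n
vPow2 n i = (+ (2 ^ toℕ i)) / 1

data BHyp (n : ℕ) : Set where
  xi=xj  : (i j : Fin n) → i Fin.< j → BHyp n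
  xi=-xj : (i j : Fin n) → i Fin.< j → BHyp n
  xi=0   : (i : Fin n) → BHyp n

onHyp : ∀ {n} → BHyp n → Subsetℚ n
onHyp (xi=xj i j _)  x = x i ≡ x j
onHyp (xi=-xj i j _) x = x i ≡ - x j
onHyp (xi=0 i)       x = x i ≡ 0ℚ

Flat : ∀ {n} → List (BHyp n) → Subsetℚ n
Flat hs x = All (λ h → onHyp h x) hs

AffIndep : ∀ {n k} → (Fin k → Vecℚ n) → Set
AffIndep {n} {k} p =
  (c : Fin k → ℚ) → sumℚ c ≡ 0ℚ → (∀ j → sumℚ (λ i → c i * p i j) ≡ 0ℚ) →
  ∀ i → c i ≡ 0ℚ

-- Dim A d : the (affine) dimension of A ⊆ ℚⁿ is d, with dim ∅ = -1.
-- dim A = k ≥ 0 : A contains k+1 affinely independent points, and any k+2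
-- points of A are affinely dependent.
Dim : ∀ {n} → Subsetℚ n → ℤ → Set
Dim {n} A (+ k) =
  (Σ (Fin (suc k) → Vecℚ n) λ p → (∀ i → A (p i)) × AffIndep p) ×
  ((p : Fin (suc (suc k)) → Vecℚ n) → (∀ i → A (p i)) → ¬ AffIndep p)
Dim A -[1+ zero ]  = ∀ x → ¬ A x
Dim A -[1+ suc _ ] = ⊥

GenericB : (n : ℕ) → Subsetℚ n → Set
GenericB n K = (hs : List (BHyp n)) (d : ℤ) →
  Dim (Flat hs) d → Dim (K ∩ Flat hs) (d ℤ.- + 1)

-- signed permutations (ω, ε) ∈ Bₙ ; ε i = - means ω(i) is barred
SignVec : ℕ → Set
SignVec n = Fin n → Sign

signed : Sign → ℚ → ℚ
signed Sign.+ q = q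
signed Sign.- q = - q

Region : ∀ {n} → Permutation′ n → SignVec n → Subsetℚ n
Region ω ε x =
  (∀ i → 0ℚ < signed (ε i) (x (ω ⟨$⟩ʳ i))) ×
  (∀ i j → i Fin.< j → signed (ε i) (x (ω ⟨$⟩ʳ i)) < signed (ε j) (x (ω ⟨$⟩ʳ j)))

RLMax : ∀ {n} → Permutation′ n → Fin n → Set
RLMax ω i = ∀ j → i Fin.< j → (ω ⟨$⟩ʳ j) Fin.< (ω ⟨$⟩ʳ i)

AllRLMaxUnbarred : ∀ {n} → Permutation′ n → SignVec n → Set
AllRLMaxUnbarred ω ε = ∀ i → RLMax ω i → ε i ≡ Sign.+

Nonempty : ∀ {n} → Subsetℚ n → Set
Nonempty {n} A = Σ (Vecℚ n) A

Bounded : ∀ {n} → Subsetℚ n → Set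
Bounded A = Σ ℚ λ B → ∀ x → A x → ∀ i → ∣ x i ∣ ≤ B

-- Every flat X of 𝓑ₙ is a linear subspace, and v is orthogonal to X only if X = 0:
-- if x ∈ X has x_m ≠ 0, recording for each j whether x_j = x_m, x_j = −x_m or neither gives a
-- sign vector σ ∈ {−1,0,1}ⁿ with x_m σ ∈ X again, and v · σ = Σⱼ σⱼ 2ʲ is a nonzero signed
-- binary number. A hyperplane w · x = c with c ≠ 0 lowers by exactly one the dimension of every
-- linear subspace on which w does not vanish identically.
--
-- In the coordinates y_l = ε_l x_{ω(l)} the region R_{ω,ε} is the chamber
-- 0 < y_1 < ⋯ < y_n, and v · x = Σ_l a_l y_l with a_l = ε_l 2^{ω(l)}. By Abel summation this is
-- Σ_k F_k (y_k − y_{k−1}) with tail sums F_k = Σ_{l ≥ k} a_l, and the sign of F_k is the sign of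
-- its largest power of two, i.e. of ε at the right-to-left maximum of ω among positions ≥ k.
-- If all right-to-left maxima are unbarred then every F_k ≥ 1, so y_n ≤ v · v on the section;
-- if the one at position i is barred then F_i ≤ −1, and rescaling y while adding ν to all y_l
-- with l ≥ i stays on H_v and gives points of the section with y_n ≥ ν, for every ν > 0.

module Submission where

open import Defs
open import Data.Nat as ℕ using (ℕ; zero; suc; _≤_)
import Data.Nat.Properties as ℕP
import Data.Nat.Coprimality as Coprime
open import Data.Fin as F using (Fin; zero; suc; toℕ)
import Data.Fin.Properties as FP
open import Data.Fin.Permutation as Perm using (Permutation′; _⟨$⟩ʳ_; _⟨$⟩ˡ_; inverseˡ; inverseʳ)
import Data.Integer as ℤ
import Data.Integer.Properties as ℤP
open import Data.Rational as ℚ using (ℚ; 0ℚ; 1ℚ; _+_; _*_; -_; _-_; 1/_; ∣_∣)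
import Data.Rational.Properties as QP
open import Data.Rational.Solver using (module +-*-Solver)
open import Data.Sign using (Sign)
open import Data.Vec.Functional using (_∷_)
open import Data.Product using (Σ; ∃-syntax; _×_; _,_; proj₁; proj₂)
open import Data.Sum using (_⊎_; inj₁; inj₂)
open import Data.Empty using (⊥-elim)
open import Data.Unit using (tt)
open import Data.Bool using (if_then_else_)
open import Data.List using (List)
import Data.List.Relation.Unary.All as All
open import Function.Bundles using (_⇔_; mk⇔)
open import Relation.Binary.PropositionalEquality
open import Relation.Nullary using (¬_; yes; no; ¬?; does)
open import Relation.Nullary.Decidable using (toWitness; decidable-stable)
open import Algebra.Bundles using (CommutativeRing)
import Algebra.Properties.Semiring.Sum as SemiringSum
import Algebra.Properties.Group as GroupProperties

open +-*-Solver
open ≡-Reasoning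
open GroupProperties QP.+-0-group using (x∙y⁻¹≈ε⇒x≈y; ⁻¹-involutive)

module Σℚ = SemiringSum (CommutativeRing.semiring QP.+-*-commutativeRing)

sumℚ≡sum : ∀ {n} (f : Fin n → ℚ) → sumℚ f ≡ Σℚ.sum f
sumℚ≡sum {zero}  f = refl
sumℚ≡sum {suc n} f = cong (f zero +_) (sumℚ≡sum (λ i → f (suc i)))

sumℚ-cong : ∀ {n} {f g : Fin n → ℚ} → (∀ i → f i ≡ g i) → sumℚ f ≡ sumℚ g
sumℚ-cong {f = f} {g} f≗g = begin
  sumℚ f    ≡⟨ sumℚ≡sum f ⟩
  Σℚ.sum f  ≡⟨ Σℚ.sum-cong-≗ f≗g ⟩
  Σℚ.sum g  ≡⟨ sumℚ≡sum g ⟨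
  sumℚ g    ∎

sumℚ-zero : ∀ {n} (f : Fin n → ℚ) → (∀ i → f i ≡ 0ℚ) → sumℚ f ≡ 0ℚ
sumℚ-zero {n} f f≗0 = begin
  sumℚ f                 ≡⟨ sumℚ-cong f≗0 ⟩
  sumℚ {n} (λ _ → 0ℚ)    ≡⟨ sumℚ≡sum {n} (λ _ → 0ℚ) ⟩
  Σℚ.sum {n} (λ _ → 0ℚ)  ≡⟨ Σℚ.sum-replicate-zero n ⟩
  0ℚ                     ∎

sumℚ-+ : ∀ {n} (f g : Fin n → ℚ) → sumℚ (λ i → f i + g i) ≡ sumℚ f + sumℚ g
sumℚ-+ f g = begin
  sumℚ (λ i → f i + g i)    ≡⟨ sumℚ≡sum (λ i → f i + g i) ⟩
  Σℚ.sum (λ i → f i + g i)  ≡⟨ Σℚ.∑-distrib-+ f g ⟩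
  Σℚ.sum f + Σℚ.sum g       ≡⟨ cong₂ _+_ (sumℚ≡sum f) (sumℚ≡sum g) ⟨
  sumℚ f + sumℚ g           ∎

*-distribˡ-sumℚ : ∀ {n} c (f : Fin n → ℚ) → c * sumℚ f ≡ sumℚ (λ i → c * f i)
*-distribˡ-sumℚ c f = begin
  c * sumℚ f                ≡⟨ cong (c *_) (sumℚ≡sum f) ⟩
  c * Σℚ.sum f              ≡⟨ Σℚ.*-distribˡ-sum c f ⟩
  Σℚ.sum (λ i → c * f i)    ≡⟨ sumℚ≡sum (λ i → c * f i) ⟨
  sumℚ (λ i → c * f i)      ∎

*-distribʳ-sumℚ : ∀ {n} c (f : Fin n → ℚ) → sumℚ f * c ≡ sumℚ (λ i → f i * c)
*-distribʳ-sumℚ c f = begin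
  sumℚ f * c                ≡⟨ cong (_* c) (sumℚ≡sum f) ⟩
  Σℚ.sum f * c              ≡⟨ Σℚ.*-distribʳ-sum c f ⟩
  Σℚ.sum (λ i → f i * c)    ≡⟨ sumℚ≡sum (λ i → f i * c) ⟨
  sumℚ (λ i → f i * c)      ∎

sumℚ-comm : ∀ {m n} (f : Fin m → Fin n → ℚ) →
  sumℚ (λ i → sumℚ (λ j → f i j)) ≡ sumℚ (λ j → sumℚ (λ i → f i j))
sumℚ-comm f = begin
  sumℚ (λ i → sumℚ (λ j → f i j))      ≡⟨ sumℚ-cong (λ i → sumℚ≡sum (f i)) ⟩
  sumℚ (λ i → Σℚ.sum (λ j → f i j))    ≡⟨ sumℚ≡sum (λ i → Σℚ.sum (f i)) ⟩
  Σℚ.sum (λ i → Σℚ.sum (λ j → f i j))  ≡⟨ Σℚ.∑-comm f ⟩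
  Σℚ.sum (λ j → Σℚ.sum (λ i → f i j))  ≡⟨ sumℚ≡sum (λ j → Σℚ.sum (λ i → f i j)) ⟨
  sumℚ (λ j → Σℚ.sum (λ i → f i j))    ≡⟨ sumℚ-cong (λ j → sumℚ≡sum (λ i → f i j)) ⟨
  sumℚ (λ j → sumℚ (λ i → f i j))      ∎

sumℚ-permute : ∀ {n} (f : Fin n → ℚ) (π : Permutation′ n) → sumℚ f ≡ sumℚ (λ i → f (π ⟨$⟩ʳ i))
sumℚ-permute f π = begin
  sumℚ f                      ≡⟨ sumℚ≡sum f ⟩
  Σℚ.sum f                    ≡⟨ Σℚ.∑-permute f π ⟩
  Σℚ.sum (λ i → f (π ⟨$⟩ʳ i))  ≡⟨ sumℚ≡sum (λ i → f (π ⟨$⟩ʳ i)) ⟨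
  sumℚ (λ i → f (π ⟨$⟩ʳ i))    ∎

sumℚ-nonNeg : ∀ {n} (f : Fin n → ℚ) → (∀ i → 0ℚ ℚ.≤ f i) → 0ℚ ℚ.≤ sumℚ f
sumℚ-nonNeg {zero}  f f≥0 = QP.≤-refl
sumℚ-nonNeg {suc n} f f≥0 = QP.+-mono-≤ (f≥0 zero) (sumℚ-nonNeg (λ i → f (suc i)) (λ i → f≥0 (suc i)))

δ : ∀ {n} → Fin n → Fin n → ℚ
δ i j = if does (i F.≟ j) then 1ℚ else 0ℚ

sumℚ-δ : ∀ {n} (J : Fin n) (f : Fin n → ℚ) → sumℚ (λ i → δ i J * f i) ≡ f J
sumℚ-δ {suc n} zero f = begin
  1ℚ * f zero + sumℚ (λ i → 0ℚ * f (suc i))  ≡⟨ cong₂ _+_ (QP.*-identityˡ (f zero)) (sumℚ-zero _ (λ i → QP.*-zeroˡ (f (suc i)))) ⟩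
  f zero + 0ℚ                                 ≡⟨ QP.+-identityʳ (f zero) ⟩
  f zero                                      ∎
sumℚ-δ {suc n} (suc J) f = begin
  0ℚ * f zero + sumℚ (λ i → δ i J * f (suc i))  ≡⟨ cong₂ _+_ (QP.*-zeroˡ (f zero)) (sumℚ-δ J (λ i → f (suc i))) ⟩
  0ℚ + f (suc J)                                ≡⟨ QP.+-identityˡ (f (suc J)) ⟩
  f (suc J)                                     ∎

*-cancelʳ-≢0 : ∀ {p q} → p * q ≡ 0ℚ → q ≢ 0ℚ → p ≡ 0ℚ
*-cancelʳ-≢0 {p} {q} pq≡0 q≢0 = begin
  p                 ≡⟨ QP.*-identityʳ p ⟨
  p * 1ℚ            ≡⟨ cong (p *_) (QP.*-inverseʳ q) ⟨
  p * (q * 1/ q)    ≡⟨ QP.*-assoc p q (1/ q) ⟨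
  (p * q) * 1/ q    ≡⟨ cong (_* 1/ q) pq≡0 ⟩
  0ℚ * 1/ q         ≡⟨ QP.*-zeroˡ (1/ q) ⟩
  0ℚ                ∎
  where instance _ = ℚ.≢-nonZero q≢0

p≡-p⇒p≡0 : ∀ {p} → p ≡ - p → p ≡ 0ℚ
p≡-p⇒p≡0 {p} p≡-p = *-cancelʳ-≢0 (begin
  p * (1ℚ + 1ℚ)  ≡⟨ solve 1 (λ p → p :* (con 1ℚ :+ con 1ℚ) := p :+ p) refl p ⟩
  p + p          ≡⟨ cong (p +_) p≡-p ⟩
  p + - p        ≡⟨ QP.+-inverseʳ p ⟩
  0ℚ             ∎) (λ ())

*-pos : ∀ {p q} → 0ℚ ℚ.< p → 0ℚ ℚ.< q → 0ℚ ℚ.< p * q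
*-pos {p} {q} 0<p 0<q = QP.positive⁻¹ _ {{QP.pos*pos⇒pos p {{ℚ.positive 0<p}} q {{ℚ.positive 0<q}}}}

≤∣∣ : ∀ p → p ℚ.≤ ∣ p ∣
≤∣∣ p with QP.≤-total 0ℚ p
... | inj₁ 0≤p = QP.≤-reflexive (sym (QP.0≤p⇒∣p∣≡p 0≤p))
... | inj₂ p≤0 = QP.≤-trans p≤0 (QP.0≤∣p∣ p)

≤-*-≥1 : ∀ {F y} → 1ℚ ℚ.≤ F → 0ℚ ℚ.≤ y → y ℚ.≤ F * y
≤-*-≥1 {F} {y} 1≤F 0≤y = subst (ℚ._≤ F * y) (QP.*-identityˡ y) (QP.*-monoʳ-≤-nonNeg y {{ℚ.nonNegative 0≤y}} 1≤F)

signed-involutive : ∀ s q → signed s (signed s q) ≡ q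
signed-involutive Sign.+ q = refl
signed-involutive Sign.- q = ⁻¹-involutive q

signed-*-signed : ∀ s p q → signed s p * signed s q ≡ p * q
signed-*-signed Sign.+ p q = refl
signed-*-signed Sign.- p q = solve 2 (λ p q → (:- p) :* (:- q) := p :* q) refl p q

signed≡* : ∀ s q → signed s q ≡ signed s 1ℚ * q
signed≡* Sign.+ q = sym (QP.*-identityˡ q)
signed≡* Sign.- q = solve 1 (λ q → :- q := (:- con 1ℚ) :* q) refl q

∣signed∣ : ∀ s q → ∣ signed s q ∣ ≡ ∣ q ∣
∣signed∣ Sign.+ q = refl
∣signed∣ Sign.- q = QP.∣-p∣≡∣p∣ q

·-zeroʳ : ∀ {n} (w : Vecℚ n) → w · (λ _ → 0ℚ) ≡ 0ℚ
·-zeroʳ w = sumℚ-zero _ (λ j → QP.*-zeroʳ (w j))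

·-lincomb : ∀ {n} (w x y : Vecℚ n) a b →
  w · (λ j → a * x j + b * y j) ≡ a * (w · x) + b * (w · y)
·-lincomb w x y a b = begin
  sumℚ (λ j → w j * (a * x j + b * y j))
    ≡⟨ sumℚ-cong (λ j → distrib (w j) (x j) (y j)) ⟩
  sumℚ (λ j → a * (w j * x j) + b * (w j * y j))
    ≡⟨ sumℚ-+ (λ j → a * (w j * x j)) (λ j → b * (w j * y j)) ⟩
  sumℚ (λ j → a * (w j * x j)) + sumℚ (λ j → b * (w j * y j))
    ≡⟨ cong₂ _+_ (*-distribˡ-sumℚ a (λ j → w j * x j)) (*-distribˡ-sumℚ b (λ j → w j * y j)) ⟨
  a * (w · x) + b * (w · y) ∎
  where
  distrib : ∀ u x y → u * (a * x + b * y) ≡ a * (u * x) + b * (u * y)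
  distrib = solve 5 (λ a b u x y → u :* (a :* x :+ b :* y) := a :* (u :* x) :+ b :* (u :* y)) refl a b

·-scale : ∀ {n} (w x : Vecℚ n) s → w · (λ j → s * x j) ≡ s * (w · x)
·-scale w x s = begin
  sumℚ (λ j → w j * (s * x j))  ≡⟨ sumℚ-cong (λ j → solve 3 (λ w s x → w :* (s :* x) := s :* (w :* x)) refl (w j) s (x j)) ⟩
  sumℚ (λ j → s * (w j * x j))  ≡⟨ *-distribˡ-sumℚ s (λ j → w j * x j) ⟨
  s * (w · x)                   ∎

·-shear : ∀ {n} (w x y z : Vecℚ n) κ →
  w · (λ j → x j + κ * (y j - z j)) ≡ w · x + κ * (w · y - w · z)
·-shear w x y z κ = begin
  w · (λ j → x j + κ * (y j - z j))
    ≡⟨ sumℚ-cong (λ j → cong (w j *_) (expand (x j) (y j) (z j))) ⟩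
  w · (λ j → 1ℚ * x j + κ * (1ℚ * y j + - 1ℚ * z j))
    ≡⟨ ·-lincomb w x (λ j → 1ℚ * y j + - 1ℚ * z j) 1ℚ κ ⟩
  1ℚ * (w · x) + κ * (w · (λ j → 1ℚ * y j + - 1ℚ * z j))
    ≡⟨ cong (λ u → 1ℚ * (w · x) + κ * u) (·-lincomb w y z 1ℚ (- 1ℚ)) ⟩
  1ℚ * (w · x) + κ * (1ℚ * (w · y) + - 1ℚ * (w · z))
    ≡⟨ expand (w · x) (w · y) (w · z) ⟨
  w · x + κ * (w · y - w · z) ∎
  where
  expand : ∀ x y z → x + κ * (y - z) ≡ 1ℚ * x + κ * (1ℚ * y + - 1ℚ * z)
  expand = solve 4 (λ κ x y z → x :+ κ :* (y :- z) := con 1ℚ :* x :+ κ :* (con 1ℚ :* y :+ :- con 1ℚ :* z)) refl κ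

·-sum : ∀ {m n} (w : Vecℚ n) (c : Fin m → ℚ) (p : Fin m → Vecℚ n) →
  w · (λ j → sumℚ (λ i → c i * p i j)) ≡ sumℚ (λ i → c i * (w · p i))
·-sum w c p = begin
  sumℚ (λ j → w j * sumℚ (λ i → c i * p i j))    ≡⟨ sumℚ-cong (λ j → *-distribˡ-sumℚ (w j) (λ i → c i * p i j)) ⟩
  sumℚ (λ j → sumℚ (λ i → w j * (c i * p i j)))  ≡⟨ sumℚ-comm (λ j i → w j * (c i * p i j)) ⟩
  sumℚ (λ i → sumℚ (λ j → w j * (c i * p i j)))  ≡⟨ sumℚ-cong (λ i → sumℚ-cong (λ j → swap (w j) (c i) (p i j))) ⟩
  sumℚ (λ i → sumℚ (λ j → c i * (w j * p i j)))  ≡⟨ sumℚ-cong (λ i → *-distribˡ-sumℚ (c i) (λ j → w j * p i j)) ⟨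
  sumℚ (λ i → c i * (w · p i))                   ∎
  where
  swap : ∀ a b c → a * (b * c) ≡ b * (a * c)
  swap = solve 3 (λ a b c → a :* (b :* c) := b :* (a :* c)) refl

·-subtract-constant : ∀ {n} (w x : Vecℚ n) c → w · (λ j → x j - c) ≡ w · x - sumℚ w * c
·-subtract-constant w x c = begin
  sumℚ (λ j → w j * (x j - c))                  ≡⟨ sumℚ-cong (λ j → expand (w j) (x j)) ⟩
  sumℚ (λ j → w j * x j + (- c) * w j)          ≡⟨ sumℚ-+ (λ j → w j * x j) (λ j → (- c) * w j) ⟩
  w · x + sumℚ (λ j → (- c) * w j)              ≡⟨ cong (w · x +_) (*-distribˡ-sumℚ (- c) w) ⟨
  w · x + (- c) * sumℚ w                        ≡⟨ solve 3 (λ u s c → u :+ (:- c) :* s := u :- s :* c) refl (w · x) (sumℚ w) c ⟩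
  w · x - sumℚ w * c                            ∎
  where
  expand : ∀ w x → w * (x - c) ≡ w * x + (- c) * w
  expand = solve 3 (λ c w x → w :* (x :- c) := w :* x :+ (:- c) :* w) refl c

AffIndep-single : ∀ {n} (x : Vecℚ n) → AffIndep {k = 1} (λ _ → x)
AffIndep-single x c Σc≡0 _ zero = trans (sym (QP.+-identityʳ (c zero))) Σc≡0

-- Pairing a relation c among y ∷ p with w gives c₀ (w · y − t) = 0.
AffIndep-∷ : ∀ {n k} (w : Vecℚ n) {t : ℚ} {y : Vecℚ n} {p : Fin k → Vecℚ n} →
  (∀ i → w · p i ≡ t) → w · y ≢ t → AffIndep p → AffIndep (y ∷ p)
AffIndep-∷ {k = k} w {t} {y} {p} wp≡t wy≢t p-indep c Σc≡0 Σcp≡0 = c≡0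
  where
  c₀ : ℚ
  c₀ = c zero
  c′ : Fin k → ℚ
  c′ i = c (suc i)
  dotted : c₀ * (w · y) + sumℚ c′ * t ≡ 0ℚ
  dotted = begin
    c₀ * (w · y) + sumℚ c′ * t                    ≡⟨ cong (c₀ * (w · y) +_) (*-distribʳ-sumℚ t c′) ⟩
    c₀ * (w · y) + sumℚ (λ i → c′ i * t)          ≡⟨ cong (c₀ * (w · y) +_) (sumℚ-cong (λ i → cong (c′ i *_) (wp≡t i))) ⟨
    sumℚ (λ i → c i * (w · (y ∷ p) i))            ≡⟨ ·-sum w c (y ∷ p) ⟨
    w · (λ j → sumℚ (λ i → c i * (y ∷ p) i j))    ≡⟨ sumℚ-cong (λ j → cong (w j *_) (Σcp≡0 j)) ⟩
    w · (λ _ → 0ℚ)                                ≡⟨ ·-zeroʳ w ⟩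
    0ℚ                                            ∎
  c₀[wy-t]≡0 : c₀ * (w · y - t) ≡ 0ℚ
  c₀[wy-t]≡0 = begin
    c₀ * (w · y - t)                                   ≡⟨ regroup c₀ (sumℚ c′) (w · y) t ⟩
    (c₀ * (w · y) + sumℚ c′ * t) - (c₀ + sumℚ c′) * t  ≡⟨ cong₂ (λ a b → a - b * t) dotted Σc≡0 ⟩
    0ℚ - 0ℚ * t                                        ≡⟨ cong (λ z → 0ℚ - z) (QP.*-zeroˡ t) ⟩
    0ℚ                                                 ∎
    where
    regroup : ∀ a b u t → a * (u - t) ≡ (a * u + b * t) - (a + b) * t
    regroup = solve 4 (λ a b u t → a :* (u :- t) := (a :* u :+ b :* t) :- (a :+ b) :* t) refl
  c₀≡0 : c₀ ≡ 0ℚ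
  c₀≡0 = *-cancelʳ-≢0 c₀[wy-t]≡0 (λ wy-t≡0 → wy≢t (x∙y⁻¹≈ε⇒x≈y (w · y) t wy-t≡0))
  drop-head : ∀ {a b} → a ≡ 0ℚ → a + b ≡ 0ℚ → b ≡ 0ℚ
  drop-head {a} {b} refl a+b≡0 = trans (sym (QP.+-identityˡ b)) a+b≡0
  c≡0 : ∀ i → c i ≡ 0ℚ
  c≡0 zero    = c₀≡0
  c≡0 (suc i) = p-indep c′ (drop-head c₀≡0 Σc≡0)
    (λ j → drop-head (trans (cong (_* y j) c₀≡0) (QP.*-zeroˡ (y j))) (Σcp≡0 j)) i

AffIndep-tail : ∀ {n k} {p : Fin (suc k) → Vecℚ n} → AffIndep p → AffIndep (λ i → p (suc i))
AffIndep-tail {p = p} p-indep c Σc≡0 Σcp≡0 i = p-indep (0ℚ ∷ c) Σ[0∷c]≡0 Σ[0∷c]p≡0 (suc i)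
  where
  Σ[0∷c]≡0 : 0ℚ + sumℚ c ≡ 0ℚ
  Σ[0∷c]≡0 = trans (QP.+-identityˡ (sumℚ c)) Σc≡0
  Σ[0∷c]p≡0 : ∀ j → 0ℚ * p zero j + sumℚ (λ i → c i * p (suc i) j) ≡ 0ℚ
  Σ[0∷c]p≡0 j = begin
    0ℚ * p zero j + sumℚ (λ i → c i * p (suc i) j)  ≡⟨ cong₂ _+_ (QP.*-zeroˡ (p zero j)) (Σcp≡0 j) ⟩
    0ℚ + 0ℚ                                          ≡⟨⟩
    0ℚ                                               ∎

AffIndep-scale : ∀ {n k} {p : Fin k → Vecℚ n} {s : ℚ} → s ≢ 0ℚ →
  AffIndep p → AffIndep (λ i j → s * p i j)
AffIndep-scale {p = p} {s} s≢0 p-indep c Σc≡0 Σcsp≡0 = p-indep c Σc≡0 Σcp≡0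
  where
  Σcp≡0 : ∀ j → sumℚ (λ i → c i * p i j) ≡ 0ℚ
  Σcp≡0 j = *-cancelʳ-≢0 (begin
    sumℚ (λ i → c i * p i j) * s   ≡⟨ *-distribʳ-sumℚ s (λ i → c i * p i j) ⟩
    sumℚ (λ i → c i * p i j * s)   ≡⟨ sumℚ-cong (λ i → rearrange (c i) (p i j)) ⟩
    sumℚ (λ i → c i * (s * p i j)) ≡⟨ Σcsp≡0 j ⟩
    0ℚ                             ∎) s≢0
    where
    rearrange : ∀ a b → a * b * s ≡ a * (s * b)
    rearrange = solve 3 (λ s a b → a :* b :* s := a :* (s :* b)) refl s

shear-combination : ∀ {n k} (p : Fin (suc (suc k)) → Vecℚ n) (J : Fin (suc k)) (κ c : Fin (suc k) → ℚ) j →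
  let μ = sumℚ (λ i → c i * κ i) in
  - μ * p zero j + sumℚ (λ i → (c i + δ i J * μ) * p (suc i) j) ≡
  sumℚ (λ i → c i * (p (suc i) j + κ i * (p (suc J) j - p zero j)))
shear-combination p J κ c j = begin
  - μ * p zero j + sumℚ (λ i → (c i + δ i J * μ) * p (suc i) j)
    ≡⟨ cong (- μ * p zero j +_) (sumℚ-cong (λ i → distrib (c i) (δ i J) (p (suc i) j))) ⟩
  - μ * p zero j + sumℚ (λ i → c i * p (suc i) j + δ i J * (μ * p (suc i) j))
    ≡⟨ cong (- μ * p zero j +_) (sumℚ-+ (λ i → c i * p (suc i) j) (λ i → δ i J * (μ * p (suc i) j))) ⟩
  - μ * p zero j + (S + sumℚ (λ i → δ i J * (μ * p (suc i) j)))
    ≡⟨ cong (λ z → - μ * p zero j + (S + z)) (sumℚ-δ J (λ i → μ * p (suc i) j)) ⟩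
  - μ * p zero j + (S + μ * p (suc J) j)
    ≡⟨ solve 4 (λ μ a b S → :- μ :* a :+ (S :+ μ :* b) := S :+ μ :* (b :- a)) refl μ (p zero j) (p (suc J) j) S ⟩
  S + μ * D
    ≡⟨ cong (S +_) (*-distribʳ-sumℚ D (λ i → c i * κ i)) ⟩
  S + sumℚ (λ i → c i * κ i * D)
    ≡⟨ sumℚ-+ (λ i → c i * p (suc i) j) (λ i → c i * κ i * D) ⟨
  sumℚ (λ i → c i * p (suc i) j + c i * κ i * D)
    ≡⟨ sumℚ-cong (λ i → solve 4 (λ c a κ D → c :* a :+ c :* κ :* D := c :* (a :+ κ :* D)) refl (c i) (p (suc i) j) (κ i) D) ⟩
  sumℚ (λ i → c i * (p (suc i) j + κ i * D)) ∎
  where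
  μ S D : ℚ
  μ = sumℚ (λ i → c i * κ i)
  S = sumℚ (λ i → c i * p (suc i) j)
  D = p (suc J) j - p zero j
  distrib : ∀ c d x → (c + d * μ) * x ≡ c * x + d * (μ * x)
  distrib = solve 4 (λ μ c d x → (c :+ d :* μ) :* x := c :* x :+ d :* (μ :* x)) refl μ

-- A relation c among the sheared points is the relation (−μ, c + μ e_J) among the p, μ = Σ cᵢ κᵢ.
AffIndep-shear : ∀ {n k} {p : Fin (suc (suc k)) → Vecℚ n} (J : Fin (suc k)) (κ : Fin (suc k) → ℚ) →
  AffIndep p → AffIndep (λ i j → p (suc i) j + κ i * (p (suc J) j - p zero j))
AffIndep-shear {k = k} {p} J κ p-indep c Σc≡0 Σcq≡0 i = c≡0
  where
  μ : ℚ
  μ = sumℚ (λ i → c i * κ i)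
  Σc′≡0 : - μ + sumℚ (λ i → c i + δ i J * μ) ≡ 0ℚ
  Σc′≡0 = begin
    - μ + sumℚ (λ i → c i + δ i J * μ)       ≡⟨ cong (- μ +_) (sumℚ-+ c (λ i → δ i J * μ)) ⟩
    - μ + (sumℚ c + sumℚ (λ i → δ i J * μ))  ≡⟨ cong₂ (λ a b → - μ + (a + b)) Σc≡0 (sumℚ-δ J (λ _ → μ)) ⟩
    - μ + (0ℚ + μ)                           ≡⟨ solve 1 (λ μ → :- μ :+ (con 0ℚ :+ μ) := con 0ℚ) refl μ ⟩
    0ℚ                                       ∎
  c′≡0 : ∀ l → ((- μ) ∷ (λ i → c i + δ i J * μ)) l ≡ 0ℚ
  c′≡0 = p-indep ((- μ) ∷ (λ i → c i + δ i J * μ)) Σc′≡0 (λ j → trans (shear-combination p J κ c j) (Σcq≡0 j))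
  μ≡0 : μ ≡ 0ℚ
  μ≡0 = QP.neg-injective (c′≡0 zero)
  c≡0 : c i ≡ 0ℚ
  c≡0 = begin
    c i                ≡⟨ QP.+-identityʳ (c i) ⟨
    c i + 0ℚ           ≡⟨ cong (c i +_) (QP.*-zeroʳ (δ i J)) ⟨
    c i + δ i J * 0ℚ   ≡⟨ cong (λ m → c i + δ i J * m) μ≡0 ⟨
    c i + δ i J * μ    ≡⟨ c′≡0 (suc i) ⟩
    0ℚ                 ∎

AffIndep⇒distinct : ∀ {n k} {p : Fin (suc (suc k)) → Vecℚ n} → AffIndep p →
  ∃[ m ] p (suc zero) m - p zero m ≢ 0ℚ
AffIndep⇒distinct {n} {k} {p} p-indep with FP.any? (λ m → ¬? (p (suc zero) m - p zero m QP.≟ 0ℚ))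
... | yes found = found
... | no none = ⊥-elim (-1≢0 (p-indep c Σc≡0 Σcp≡0 zero))
  where
  -1≢0 : - 1ℚ ≢ 0ℚ
  -1≢0 ()
  c : Fin (suc (suc k)) → ℚ
  c = (- 1ℚ) ∷ 1ℚ ∷ λ _ → 0ℚ
  Σc≡0 : sumℚ c ≡ 0ℚ
  Σc≡0 = cong (λ z → - 1ℚ + (1ℚ + z)) (sumℚ-zero {k} (λ _ → 0ℚ) (λ _ → refl))
  p₁-p₀≡0 : ∀ m → p (suc zero) m - p zero m ≡ 0ℚ
  p₁-p₀≡0 m with p (suc zero) m - p zero m QP.≟ 0ℚ
  ... | yes eq = eq
  ... | no neq = ⊥-elim (none (m , neq))
  Σcp≡0 : ∀ j → sumℚ (λ i → c i * p i j) ≡ 0ℚ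
  Σcp≡0 j = begin
    - 1ℚ * p zero j + (1ℚ * p (suc zero) j + sumℚ (λ i → 0ℚ * p (suc (suc i)) j))
      ≡⟨ cong (λ z → - 1ℚ * p zero j + (1ℚ * p (suc zero) j + z)) (sumℚ-zero _ (λ i → QP.*-zeroˡ (p (suc (suc i)) j))) ⟩
    - 1ℚ * p zero j + (1ℚ * p (suc zero) j + 0ℚ)
      ≡⟨ solve 2 (λ a b → :- con 1ℚ :* a :+ (con 1ℚ :* b :+ con 0ℚ) := b :- a) refl (p zero j) (p (suc zero) j) ⟩
    p (suc zero) j - p zero j
      ≡⟨ p₁-p₀≡0 j ⟩
    0ℚ ∎

Nonzero : ∀ {n} → Vecℚ n → Set
Nonzero x = ∃[ m ] x m ≢ 0ℚ

record IsLinearSubspace {n} (S : Subsetℚ n) : Set where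
  field
    ∈-resp-≗ : ∀ {x y} → (∀ j → x j ≡ y j) → S x → S y
    0∈       : S (λ _ → 0ℚ)
    lincomb∈ : ∀ a b {x y} → S x → S y → S (λ j → a * x j + b * y j)

  scale∈ : ∀ s {x} → S x → S (λ j → s * x j)
  scale∈ s {x} x∈ = ∈-resp-≗ (λ j → solve 2 (λ s x → s :* x :+ con 0ℚ :* x := s :* x) refl s (x j)) (lincomb∈ s 0ℚ x∈ x∈)

  -∈ : ∀ {x y} → S x → S y → S (λ j → x j - y j)
  -∈ {x} {y} x∈ y∈ = ∈-resp-≗ (λ j → solve 2 (λ x y → con 1ℚ :* x :+ :- con 1ℚ :* y := x :- y) refl (x j) (y j))
    (lincomb∈ 1ℚ (- 1ℚ) x∈ y∈)

  shear∈ : ∀ κ {x y z} → S x → S y → S z → S (λ j → x j + κ * (y j - z j))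
  shear∈ κ {x} x∈ y∈ z∈ = ∈-resp-≗ (λ j → cong (_+ _) (QP.*-identityˡ (x j))) (lincomb∈ 1ℚ κ x∈ (-∈ y∈ z∈))

module _ {n} {S : Subsetℚ n} (S-linear : IsLinearSubspace S) (w : Vecℚ n) {c : ℚ} (c≢0 : c ≢ 0ℚ)
         (w-nondegenerate : ∀ {x} → S x → Nonzero x → ∃[ z ] S z × w · z ≢ 0ℚ) where

  open IsLinearSubspace S-linear

  private
    K : Subsetℚ n
    K x = w · x ≡ c

  NoIndepPoints : ℕ → Set
  NoIndepPoints k = (p : Fin k → Vecℚ n) → (∀ i → S (p i)) → ¬ AffIndep p

  section-bounded : ∀ {k} → NoIndepPoints (suc k) →
    (q : Fin k → Vecℚ n) → (∀ i → (K ∩ S) (q i)) → ¬ AffIndep q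
  section-bounded none q q∈ q-indep = none ((λ _ → 0ℚ) ∷ q) (λ { zero → 0∈ ; (suc i) → proj₂ (q∈ i) })
    (AffIndep-∷ w (λ i → proj₁ (q∈ i)) (λ w·0≡c → c≢0 (trans (sym w·0≡c) (·-zeroʳ w))) q-indep)

  module SectionPoints {k} (p : Fin (suc (suc k)) → Vecℚ n) (p∈S : ∀ i → S (p i)) (p-indep : AffIndep p) where

    t : Fin (suc (suc k)) → ℚ
    t l = w · p l

    Points : Set
    Points = Σ (Fin (suc k) → Vecℚ n) λ q → (∀ i → (K ∩ S) (q i)) × AffIndep q

    shear-points : (J : Fin (suc k)) → t (suc J) ≢ t zero → Points
    shear-points J tJ≢t₀ = q , (λ i → q∈K i , shear∈ (κ i) (p∈S (suc i)) (p∈S (suc J)) (p∈S zero)) , AffIndep-shear {p = p} J κ p-indep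
      where
      Δ : ℚ
      Δ = t (suc J) - t zero
      instance
        Δ-nonZero : ℚ.NonZero Δ
        Δ-nonZero = ℚ.≢-nonZero (λ Δ≡0 → tJ≢t₀ (x∙y⁻¹≈ε⇒x≈y (t (suc J)) (t zero) Δ≡0))
      κ : Fin (suc k) → ℚ
      κ i = (c - t (suc i)) * 1/ Δ
      q : Fin (suc k) → Vecℚ n
      q i j = p (suc i) j + κ i * (p (suc J) j - p zero j)
      q∈K : ∀ i → w · q i ≡ c
      q∈K i = begin
        w · q i                                  ≡⟨ ·-shear w (p (suc i)) (p (suc J)) (p zero) (κ i) ⟩
        t (suc i) + (c - t (suc i)) * 1/ Δ * Δ   ≡⟨ cong (λ u → t (suc i) + u) (QP.*-assoc (c - t (suc i)) (1/ Δ) Δ) ⟩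
        t (suc i) + (c - t (suc i)) * (1/ Δ * Δ) ≡⟨ cong (λ u → t (suc i) + (c - t (suc i)) * u) (QP.*-inverseˡ Δ) ⟩
        t (suc i) + (c - t (suc i)) * 1ℚ         ≡⟨ solve 2 (λ a c → a :+ (c :- a) :* con 1ℚ := c) refl (t (suc i)) c ⟩
        c                                        ∎

    scale-points : (∀ J → t (suc J) ≡ t zero) → t zero ≢ 0ℚ → Points
    scale-points tJ≡t₀ t₀≢0 = q , (λ i → q∈K i , scale∈ s (p∈S (suc i))) , AffIndep-scale {p = λ i → p (suc i)} s≢0 (AffIndep-tail {p = p} p-indep)
      where
      instance
        t₀-nonZero : ℚ.NonZero (t zero)
        t₀-nonZero = ℚ.≢-nonZero t₀≢0
      s : ℚ
      s = c * 1/ t zero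
      st₀≡c : s * t zero ≡ c
      st₀≡c = begin
        c * 1/ t zero * t zero    ≡⟨ QP.*-assoc c (1/ t zero) (t zero) ⟩
        c * (1/ t zero * t zero)  ≡⟨ cong (c *_) (QP.*-inverseˡ (t zero)) ⟩
        c * 1ℚ                    ≡⟨ QP.*-identityʳ c ⟩
        c                         ∎
      s≢0 : s ≢ 0ℚ
      s≢0 s≡0 = c≢0 (trans (sym st₀≡c) (trans (cong (_* t zero) s≡0) (QP.*-zeroˡ (t zero))))
      q : Fin (suc k) → Vecℚ n
      q i j = s * p (suc i) j
      q∈K : ∀ i → w · q i ≡ c
      q∈K i = trans (·-scale w (p (suc i)) s) (trans (cong (s *_) (tJ≡t₀ i)) st₀≡c)

    degenerate : (∀ l → t l ≡ 0ℚ) → ¬ NoIndepPoints (suc (suc (suc k)))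
    degenerate t≡0 none =
      let z , z∈S , w·z≢0 = w-nondegenerate (-∈ (p∈S (suc zero)) (p∈S zero)) (AffIndep⇒distinct {p = p} p-indep)
      in none (z ∷ p) (λ { zero → z∈S ; (suc i) → p∈S i }) (AffIndep-∷ w {p = p} t≡0 w·z≢0 p-indep)

    level-points : (∀ J → t (suc J) ≡ t zero) → NoIndepPoints (suc (suc (suc k))) → Points
    level-points tJ≡t₀ none with t zero QP.≟ 0ℚ
    ... | no t₀≢0  = scale-points tJ≡t₀ t₀≢0
    ... | yes t₀≡0 = ⊥-elim (degenerate (λ { zero → t₀≡0 ; (suc J) → trans (tJ≡t₀ J) t₀≡0 }) none)

    -- Either w separates two of the points (shear along their difference onto K), or all
    -- lie on one level set of w: a nonzero level is rescaled onto K, and the zero level is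
    -- impossible, since then a point of S off ker w would extend p to k + 3 independent points.
    section-points : NoIndepPoints (suc (suc (suc k))) → Points
    section-points none with FP.any? (λ J → ¬? (t (suc J) QP.≟ t zero))
    ... | yes (J , tJ≢t₀) = shear-points J tJ≢t₀
    ... | no no-J = level-points (λ J → decidable-stable (t (suc J) QP.≟ t zero) (λ tJ≢t₀ → no-J (J , tJ≢t₀))) none

  Dim-section : ∀ d → Dim S d → Dim (K ∩ S) (d ℤ.- ℤ.+ 1)
  Dim-section (ℤ.+ zero) (_ , none) x x∈ = section-bounded none (λ _ → x) (λ _ → x∈) (AffIndep-single x)
  Dim-section (ℤ.+ suc k) ((p , p∈S , p-indep) , none) = SectionPoints.section-points p p∈S p-indep none , section-bounded none
  Dim-section ℤ.-[1+ zero ] empty = ⊥-elim (empty _ 0∈)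
  Dim-section ℤ.-[1+ suc _ ] ()

+/1-homo-+ : ∀ a b → ℤ.+ (a ℕ.+ b) ℚ./ 1 ≡ ℤ.+ a ℚ./ 1 + ℤ.+ b ℚ./ 1
+/1-homo-+ a b = begin
  ℤ.+ (a ℕ.+ b) ℚ./ 1                            ≡⟨ cong (ℚ._/ 1) (ℤP.pos-+ a b) ⟩
  (ℤ.+ a ℤ.+ ℤ.+ b) ℚ./ 1                         ≡⟨ cong (ℚ._/ 1) (cong₂ ℤ._+_ (ℤP.*-identityʳ (ℤ.+ a)) (ℤP.*-identityʳ (ℤ.+ b))) ⟨
  (ℤ.+ a ℤ.* ℤ.+ 1 ℤ.+ ℤ.+ b ℤ.* ℤ.+ 1) ℚ./ 1     ≡⟨⟩
  ℚ.mkℚ (ℤ.+ a) 0 (coprime a) + ℚ.mkℚ (ℤ.+ b) 0 (coprime b)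
                                                  ≡⟨ cong₂ _+_ (QP.normalize-coprime (coprime a)) (QP.normalize-coprime (coprime b)) ⟨
  ℤ.+ a ℚ./ 1 + ℤ.+ b ℚ./ 1                       ∎
  where
  coprime : ∀ m → Coprime.Coprime m 1
  coprime m = Coprime.sym (Coprime.1-coprimeTo m)

2^_ : ℕ → ℚ
2^ m = ℤ.+ (2 ℕ.^ m) ℚ./ 1

2^-suc : ∀ m → 2^ suc m ≡ 2^ m + 2^ m
2^-suc m = trans (cong (λ k → ℤ.+ (2 ℕ.^ m ℕ.+ k) ℚ./ 1) (ℕP.+-identityʳ (2 ℕ.^ m))) (+/1-homo-+ (2 ℕ.^ m) (2 ℕ.^ m))

2^-pos : ∀ m → 0ℚ ℚ.< 2^ m
2^-pos zero    = toWitness {a? = 0ℚ QP.<? 1ℚ} tt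
2^-pos (suc m) = subst (0ℚ ℚ.<_) (sym (2^-suc m)) (QP.+-mono-< (2^-pos m) (2^-pos m))

2^-<-suc : ∀ m → 2^ m ℚ.< 2^ suc m
2^-<-suc m = subst₂ ℚ._<_ (QP.+-identityʳ (2^ m)) (sym (2^-suc m)) (QP.+-monoʳ-< (2^ m) (2^-pos m))

2^-mono-< : ∀ {m m′} → m ℕ.< m′ → 2^ m ℚ.< 2^ m′
2^-mono-< {m} {suc m′} m<1+m′ with ℕP.m<1+n⇒m<n∨m≡n m<1+m′
... | inj₁ m<m′  = QP.<-trans (2^-mono-< m<m′) (2^-<-suc m′)
... | inj₂ refl  = 2^-<-suc m

data SignedDigit : ℚ → Set where
  0ᵈ  : SignedDigit 0ℚ
  ±1ᵈ : (s : Sign) → SignedDigit (signed s 1ℚ)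

SignedDigit-* : ∀ {p q} → SignedDigit p → SignedDigit q → SignedDigit (p * q)
SignedDigit-* {q = q} 0ᵈ _           = subst SignedDigit (sym (QP.*-zeroˡ q)) 0ᵈ
SignedDigit-* (±1ᵈ s) 0ᵈ             = subst SignedDigit (sym (QP.*-zeroʳ (signed s 1ℚ))) 0ᵈ
SignedDigit-* (±1ᵈ Sign.+) (±1ᵈ Sign.+) = ±1ᵈ Sign.+
SignedDigit-* (±1ᵈ Sign.+) (±1ᵈ Sign.-) = ±1ᵈ Sign.-
SignedDigit-* (±1ᵈ Sign.-) (±1ᵈ Sign.+) = ±1ᵈ Sign.-
SignedDigit-* (±1ᵈ Sign.-) (±1ᵈ Sign.-) = ±1ᵈ Sign.+

binValue : ∀ {n} → (Fin n → ℚ) → ℚ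
binValue {n} d = vPow2 n · d

binValue-suc : ∀ {n} (d : Fin (suc n) → ℚ) →
  binValue d ≡ d zero + (binValue (λ i → d (suc i)) + binValue (λ i → d (suc i)))
binValue-suc d = cong₂ _+_ (QP.*-identityˡ (d zero)) (begin
  sumℚ (λ i → 2^ suc (toℕ i) * d (suc i))
    ≡⟨ sumℚ-cong (λ i → cong (_* d (suc i)) (2^-suc (toℕ i))) ⟩
  sumℚ (λ i → (2^ toℕ i + 2^ toℕ i) * d (suc i))
    ≡⟨ sumℚ-cong (λ i → QP.*-distribʳ-+ (d (suc i)) (2^ toℕ i) (2^ toℕ i)) ⟩
  sumℚ (λ i → 2^ toℕ i * d (suc i) + 2^ toℕ i * d (suc i))
    ≡⟨ sumℚ-+ (λ i → 2^ toℕ i * d (suc i)) (λ i → 2^ toℕ i * d (suc i)) ⟩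
  binValue (λ i → d (suc i)) + binValue (λ i → d (suc i)) ∎)

binValue-zero : ∀ {n} (d : Fin n → ℚ) → (∀ i → d i ≡ 0ℚ) → binValue d ≡ 0ℚ
binValue-zero {n} d d≡0 = sumℚ-zero _ (λ i → trans (cong (vPow2 n i *_) (d≡0 i)) (QP.*-zeroʳ (vPow2 n i)))

binValue-leading : ∀ {n} (d : Fin (suc n) → ℚ) → (∀ i → d (suc i) ≡ 0ℚ) → binValue d ≡ d zero
binValue-leading d tail≡0 = begin
  binValue d                                        ≡⟨ binValue-suc d ⟩
  d zero + (binValue tail + binValue tail)          ≡⟨ cong (λ t → d zero + (t + t)) (binValue-zero tail tail≡0) ⟩
  d zero + 0ℚ                                       ≡⟨ QP.+-identityʳ (d zero) ⟩
  d zero                                            ∎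
  where
  tail : Fin _ → ℚ
  tail i = d (suc i)

digit+double-≥1 : ∀ {d} t → SignedDigit d → 1ℚ ℚ.≤ t → 1ℚ ℚ.≤ d + (t + t)
digit+double-≥1 {d} t d-digit 1≤t = QP.≤-trans (base d-digit) (QP.+-monoʳ-≤ d (QP.+-mono-≤ 1≤t 1≤t))
  where
  base : ∀ {d} → SignedDigit d → 1ℚ ℚ.≤ d + (1ℚ + 1ℚ)
  base 0ᵈ          = toWitness {a? = 1ℚ QP.≤? 0ℚ + (1ℚ + 1ℚ)} tt
  base (±1ᵈ Sign.+) = toWitness {a? = 1ℚ QP.≤? 1ℚ + (1ℚ + 1ℚ)} tt
  base (±1ᵈ Sign.-) = toWitness {a? = 1ℚ QP.≤? - 1ℚ + (1ℚ + 1ℚ)} tt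

digit+double-≤-1 : ∀ {d} t → SignedDigit d → t ℚ.≤ - 1ℚ → d + (t + t) ℚ.≤ - 1ℚ
digit+double-≤-1 {d} t d-digit t≤-1 = QP.≤-trans (QP.+-monoʳ-≤ d (QP.+-mono-≤ t≤-1 t≤-1)) (base d-digit)
  where
  base : ∀ {d} → SignedDigit d → d + (- 1ℚ + - 1ℚ) ℚ.≤ - 1ℚ
  base 0ᵈ          = toWitness {a? = 0ℚ + (- 1ℚ + - 1ℚ) QP.≤? - 1ℚ} tt
  base (±1ᵈ Sign.+) = toWitness {a? = 1ℚ + (- 1ℚ + - 1ℚ) QP.≤? - 1ℚ} tt
  base (±1ᵈ Sign.-) = toWitness {a? = - 1ℚ + (- 1ℚ + - 1ℚ) QP.≤? - 1ℚ} tt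

digit-trichotomy : ∀ {d} → SignedDigit d → d ≡ 0ℚ ⊎ 1ℚ ℚ.≤ d ⊎ d ℚ.≤ - 1ℚ
digit-trichotomy 0ᵈ           = inj₁ refl
digit-trichotomy (±1ᵈ Sign.+) = inj₂ (inj₁ QP.≤-refl)
digit-trichotomy (±1ᵈ Sign.-) = inj₂ (inj₂ QP.≤-refl)

binValue-trichotomy : ∀ {n} (d : Fin n → ℚ) → (∀ i → SignedDigit (d i)) →
  (∀ i → d i ≡ 0ℚ) ⊎ 1ℚ ℚ.≤ binValue d ⊎ binValue d ℚ.≤ - 1ℚ
binValue-trichotomy {zero} d _ = inj₁ (λ ())
binValue-trichotomy {suc n} d digits with binValue-trichotomy (λ i → d (suc i)) (λ i → digits (suc i))
... | inj₂ (inj₁ 1≤t)  = inj₂ (inj₁ (subst (1ℚ ℚ.≤_) (sym (binValue-suc d)) (digit+double-≥1 _ (digits zero) 1≤t)))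
... | inj₂ (inj₂ t≤-1) = inj₂ (inj₂ (subst (ℚ._≤ - 1ℚ) (sym (binValue-suc d)) (digit+double-≤-1 _ (digits zero) t≤-1)))
... | inj₁ tail≡0 with digit-trichotomy (digits zero)
...   | inj₁ d₀≡0        = inj₁ λ { zero → d₀≡0 ; (suc i) → tail≡0 i }
...   | inj₂ (inj₁ 1≤d₀)  = inj₂ (inj₁ (subst (1ℚ ℚ.≤_) (sym (binValue-leading d tail≡0)) 1≤d₀))
...   | inj₂ (inj₂ d₀≤-1) = inj₂ (inj₂ (subst (ℚ._≤ - 1ℚ) (sym (binValue-leading d tail≡0)) d₀≤-1))

binValue-≢0 : ∀ {n} (d : Fin n → ℚ) → (∀ i → SignedDigit (d i)) → ∀ m → d m ≢ 0ℚ → binValue d ≢ 0ℚ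
binValue-≢0 d digits m dm≢0 value≡0 with binValue-trichotomy d digits
... | inj₁ d≡0          = dm≢0 (d≡0 m)
... | inj₂ (inj₁ 1≤v)   = QP.<-irrefl refl (QP.<-≤-trans (toWitness {a? = 0ℚ QP.<? 1ℚ} tt) (subst (1ℚ ℚ.≤_) value≡0 1≤v))
... | inj₂ (inj₂ v≤-1)  = QP.<-irrefl refl (QP.≤-<-trans (subst (ℚ._≤ - 1ℚ) value≡0 v≤-1) (toWitness {a? = - 1ℚ QP.<? 0ℚ} tt))

binValue-top : ∀ {n} (d : Fin n → ℚ) (e : Fin n) → (∀ i → SignedDigit (d i)) →
  d e ≡ 1ℚ → (∀ i → e F.< i → d i ≡ 0ℚ) → 1ℚ ℚ.≤ binValue d
binValue-top {suc n} d zero digits de≡1 above≡0 =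
  QP.≤-reflexive (sym (trans (binValue-leading d (λ i → above≡0 (suc i) (ℕ.s≤s ℕ.z≤n))) de≡1))
binValue-top {suc n} d (suc e) digits de≡1 above≡0 =
  subst (1ℚ ℚ.≤_) (sym (binValue-suc d)) (digit+double-≥1 _ (digits zero)
    (binValue-top (λ i → d (suc i)) e (λ i → digits (suc i)) de≡1 (λ i e<i → above≡0 (suc i) (ℕ.s≤s e<i))))

onHyp-resp-≗ : ∀ {n} (h : BHyp n) {x y : Vecℚ n} → (∀ j → x j ≡ y j) → onHyp h x → onHyp h y
onHyp-resp-≗ (xi=xj i j _)  x≗y xi≡xj  = trans (sym (x≗y i)) (trans xi≡xj (x≗y j))
onHyp-resp-≗ (xi=-xj i j _) x≗y xi≡-xj = trans (sym (x≗y i)) (trans xi≡-xj (cong -_ (x≗y j)))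
onHyp-resp-≗ (xi=0 i)       x≗y xi≡0   = trans (sym (x≗y i)) xi≡0

onHyp-zero : ∀ {n} (h : BHyp n) → onHyp h (λ _ → 0ℚ)
onHyp-zero (xi=xj i j _)  = refl
onHyp-zero (xi=-xj i j _) = refl
onHyp-zero (xi=0 i)       = refl

onHyp-lincomb : ∀ {n} (h : BHyp n) a b {x y : Vecℚ n} → onHyp h x → onHyp h y → onHyp h (λ j → a * x j + b * y j)
onHyp-lincomb (xi=xj i j _)  a b xi≡xj yi≡yj = cong₂ (λ u v → a * u + b * v) xi≡xj yi≡yj
onHyp-lincomb (xi=-xj i j _) a b {x} {y} xi≡-xj yi≡-yj = begin
  a * x i + b * y i          ≡⟨ cong₂ (λ u v → a * u + b * v) xi≡-xj yi≡-yj ⟩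
  a * - x j + b * - y j      ≡⟨ solve 4 (λ a b u v → a :* (:- u) :+ b :* (:- v) := :- (a :* u :+ b :* v)) refl a b (x j) (y j) ⟩
  - (a * x j + b * y j)      ∎
onHyp-lincomb (xi=0 i)       a b xi≡0 yi≡0 = begin
  a * _ + b * _    ≡⟨ cong₂ (λ u v → a * u + b * v) xi≡0 yi≡0 ⟩
  a * 0ℚ + b * 0ℚ  ≡⟨ cong₂ _+_ (QP.*-zeroʳ a) (QP.*-zeroʳ b) ⟩
  0ℚ               ∎

onHyp-odd : ∀ {n} (h : BHyp n) (φ : ℚ → ℚ) → (∀ q → φ (- q) ≡ - φ q) → φ 0ℚ ≡ 0ℚ →
  {x : Vecℚ n} → onHyp h x → onHyp h (λ j → φ (x j))
onHyp-odd (xi=xj i j _)  φ φ-odd φ0≡0 xi≡xj = cong φ xi≡xj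
onHyp-odd (xi=-xj i j _) φ φ-odd φ0≡0 {x} xi≡-xj = trans (cong φ xi≡-xj) (φ-odd (x j))
onHyp-odd (xi=0 i)       φ φ-odd φ0≡0 xi≡0 = trans (cong φ xi≡0) φ0≡0

Flat-isLinearSubspace : ∀ {n} (hs : List (BHyp n)) → IsLinearSubspace (Flat hs)
Flat-isLinearSubspace hs = record
  { ∈-resp-≗ = λ x≗y → All.map (λ {h} → onHyp-resp-≗ h x≗y)
  ; 0∈       = All.tabulate (λ {h} _ → onHyp-zero h)
  ; lincomb∈ = λ a b x∈ y∈ → All.zipWith (λ {h} (hx , hy) → onHyp-lincomb h a b hx hy) (x∈ , y∈)
  }

signPattern : ℚ → ℚ → ℚ
signPattern a q with q QP.≟ a | q QP.≟ - a
... | yes _ | _     = 1ℚ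
... | no _  | yes _ = - 1ℚ
... | no _  | no _  = 0ℚ

signPattern-digit : ∀ a q → SignedDigit (signPattern a q)
signPattern-digit a q with q QP.≟ a | q QP.≟ - a
... | yes _ | _     = ±1ᵈ Sign.+
... | no _  | yes _ = ±1ᵈ Sign.-
... | no _  | no _  = 0ᵈ

signPattern-self : ∀ a → signPattern a a ≡ 1ℚ
signPattern-self a with a QP.≟ a
... | yes _   = refl
... | no a≢a  = ⊥-elim (a≢a refl)

signPattern-zero : ∀ {a} → a ≢ 0ℚ → signPattern a 0ℚ ≡ 0ℚ
signPattern-zero {a} a≢0 with 0ℚ QP.≟ a | 0ℚ QP.≟ - a
... | yes 0≡a | _      = ⊥-elim (a≢0 (sym 0≡a))
... | no _    | yes 0≡-a = ⊥-elim (a≢0 (QP.neg-injective (sym 0≡-a)))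
... | no _    | no _   = refl

signPattern-odd : ∀ {a} → a ≢ 0ℚ → ∀ q → signPattern a (- q) ≡ - signPattern a q
signPattern-odd {a} a≢0 q with q QP.≟ a | q QP.≟ - a | - q QP.≟ a | - q QP.≟ - a
... | yes q≡a | _         | yes -q≡a | _          = ⊥-elim (a≢0 (p≡-p⇒p≡0 (trans (sym -q≡a) (cong -_ q≡a))))
... | yes _   | _         | no _     | yes _      = refl
... | yes q≡a | _         | no _     | no -q≢-a   = ⊥-elim (-q≢-a (cong -_ q≡a))
... | no _    | yes _     | yes _    | _          = refl
... | no _    | yes q≡-a  | no -q≢a  | _          = ⊥-elim (-q≢a (trans (cong -_ q≡-a) (⁻¹-involutive a)))
... | no _    | no q≢-a   | yes -q≡a | _          = ⊥-elim (q≢-a (trans (sym (⁻¹-involutive q)) (cong -_ -q≡a)))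
... | no q≢a  | no _      | no _     | yes -q≡-a  = ⊥-elim (q≢a (QP.neg-injective -q≡-a))
... | no _    | no _      | no _     | no _       = refl

Flat-nondegenerate : ∀ {n} (hs : List (BHyp n)) {x : Vecℚ n} → Flat hs x → Nonzero x →
  ∃[ z ] Flat hs z × vPow2 n · z ≢ 0ℚ
Flat-nondegenerate {n} hs {x} x∈ (m , xm≢0) = z , z∈ , v·z≢0
  where
  a : ℚ
  a = x m
  digits : Fin n → ℚ
  digits j = signPattern a (x j)
  z : Vecℚ n
  z j = a * digits j
  z∈ : Flat hs z
  z∈ = All.map (λ {h} → onHyp-odd h (λ q → a * signPattern a q)
         (λ q → trans (cong (a *_) (signPattern-odd xm≢0 q)) (sym (QP.neg-distribʳ-* a (signPattern a q))))
         (trans (cong (a *_) (signPattern-zero xm≢0)) (QP.*-zeroʳ a))) x∈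
  value≢0 : binValue digits ≢ 0ℚ
  value≢0 = binValue-≢0 digits (λ j → signPattern-digit a (x j)) m
              (λ dm≡0 → 1≢0 (trans (sym (signPattern-self a)) dm≡0))
    where
    1≢0 : 1ℚ ≢ 0ℚ
    1≢0 ()
  v·z≢0 : vPow2 n · z ≢ 0ℚ
  v·z≢0 v·z≡0 = value≢0 (*-cancelʳ-≢0 (trans (QP.*-comm (binValue digits) a) (trans (sym (·-scale (vPow2 n) digits a)) v·z≡0)) xm≢0)

𝟙[_≤_] : ∀ {n} → Fin n → Fin n → ℚ
𝟙[ k ≤ l ] with k FP.≤? l
... | yes _ = 1ℚ
... | no _  = 0ℚ

𝟙-≤ : ∀ {n} {k l : Fin n} → k F.≤ l → 𝟙[ k ≤ l ] ≡ 1ℚ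
𝟙-≤ {k = k} {l} k≤l with k FP.≤? l
... | yes _   = refl
... | no k≰l  = ⊥-elim (k≰l k≤l)

𝟙-≰ : ∀ {n} {k l : Fin n} → ¬ k F.≤ l → 𝟙[ k ≤ l ] ≡ 0ℚ
𝟙-≰ {k = k} {l} k≰l with k FP.≤? l
... | yes k≤l = ⊥-elim (k≰l k≤l)
... | no _    = refl

𝟙-suc : ∀ {n} (k l : Fin n) → 𝟙[ suc k ≤ suc l ] ≡ 𝟙[ k ≤ l ]
𝟙-suc k l with k FP.≤? l
... | yes k≤l = 𝟙-≤ (ℕ.s≤s k≤l)
... | no k≰l  = 𝟙-≰ (λ sk≤sl → k≰l (ℕ.s≤s⁻¹ sk≤sl))

𝟙-digit : ∀ {n} (k l : Fin n) → SignedDigit 𝟙[ k ≤ l ]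
𝟙-digit k l with k FP.≤? l
... | yes _ = ±1ᵈ Sign.+
... | no _  = 0ᵈ

𝟙-mono : ∀ {n} (k : Fin n) {l l′ : Fin n} → l F.≤ l′ → 𝟙[ k ≤ l ] ℚ.≤ 𝟙[ k ≤ l′ ]
𝟙-mono k {l} {l′} l≤l′ with k FP.≤? l
... | yes k≤l = QP.≤-reflexive (sym (𝟙-≤ (ℕP.≤-trans k≤l l≤l′)))
... | no _ with k FP.≤? l′
...   | yes _ = toWitness {a? = 0ℚ QP.≤? 1ℚ} tt
...   | no _  = QP.≤-refl

tailSum : ∀ {n} → (Fin n → ℚ) → Fin n → ℚ
tailSum a k = sumℚ (λ l → 𝟙[ k ≤ l ] * a l)

tailSum-zero : ∀ {n} (a : Fin (suc n) → ℚ) → tailSum a zero ≡ sumℚ a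
tailSum-zero a = sumℚ-cong (λ l → trans (cong (_* a l) (𝟙-≤ {k = zero} {l} ℕ.z≤n)) (QP.*-identityˡ (a l)))

tailSum-suc : ∀ {n} (a : Fin (suc n) → ℚ) k → tailSum a (suc k) ≡ tailSum (λ l → a (suc l)) k
tailSum-suc a k = begin
  𝟙[ suc k ≤ zero ] * a zero + sumℚ (λ l → 𝟙[ suc k ≤ suc l ] * a (suc l))
    ≡⟨ cong₂ _+_ (trans (cong (_* a zero) (𝟙-≰ {k = suc k} {zero} (λ ()))) (QP.*-zeroˡ (a zero))) (sumℚ-cong (λ l → cong (_* a (suc l)) (𝟙-suc k l))) ⟩
  0ℚ + tailSum (λ l → a (suc l)) k
    ≡⟨ QP.+-identityˡ _ ⟩
  tailSum (λ l → a (suc l)) k ∎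

Monotone : ∀ {n} → (Fin n → ℚ) → Set
Monotone y = ∀ {i j} → i F.≤ j → y i ℚ.≤ y j

Chamber : ∀ {n} → (Fin n → ℚ) → Set
Chamber y = (∀ i → 0ℚ ℚ.< y i) × (∀ i j → i F.< j → y i ℚ.< y j)

Chamber⇒Monotone : ∀ {n} {y : Fin n → ℚ} → Chamber y → Monotone y
Chamber⇒Monotone {y = y} (_ , increasing) {i} {j} i≤j with ℕP.m≤n⇒m<n∨m≡n i≤j
... | inj₁ i<j = QP.<⇒≤ (increasing i j i<j)
... | inj₂ i≡j = QP.≤-reflexive (cong y (FP.toℕ-injective i≡j))

-- Abel summation: a · y = Σₖ Fₖ (yₖ − yₖ₋₁), all Fₖ ≥ 1 and all increments are ≥ 0.
last≤· : ∀ {m} (a y : Fin (suc m) → ℚ) → (∀ k → 1ℚ ℚ.≤ tailSum a k) → Monotone y → 0ℚ ℚ.≤ y zero →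
  y (F.fromℕ m) ℚ.≤ a · y
last≤· {zero} a y F≥1 y-mono 0≤y₀ = subst (y zero ℚ.≤_) F₀y₀≡a·y (≤-*-≥1 (F≥1 zero) 0≤y₀)
  where
  F₀y₀≡a·y : tailSum a zero * y zero ≡ a · y
  F₀y₀≡a·y = begin
    tailSum a zero * y zero   ≡⟨ cong (_* y zero) (tailSum-zero a) ⟩
    (a zero + 0ℚ) * y zero    ≡⟨ solve 2 (λ a y → (a :+ con 0ℚ) :* y := a :* y :+ con 0ℚ) refl (a zero) (y zero) ⟩
    a · y                     ∎
last≤· {suc m} a y F≥1 y-mono 0≤y₀ =
  subst₂ ℚ._≤_ (solve 2 (λ y₀ z → y₀ :+ (z :- y₀) := z) refl (y zero) (y (F.fromℕ (suc m)))) split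
    (QP.+-mono-≤ (≤-*-≥1 (F≥1 zero) 0≤y₀) IH)
  where
  a′ y′ : Fin (suc m) → ℚ
  a′ l = a (suc l)
  y′ l = y (suc l) - y zero
  IH : y′ (F.fromℕ m) ℚ.≤ a′ · y′
  IH = last≤· a′ y′ (λ k → subst (1ℚ ℚ.≤_) (tailSum-suc a k) (F≥1 (suc k)))
         (λ l≤l′ → QP.+-monoˡ-≤ (- y zero) (y-mono (ℕ.s≤s l≤l′)))
         (subst (ℚ._≤ y′ zero) (QP.+-inverseʳ (y zero)) (QP.+-monoˡ-≤ (- y zero) (y-mono ℕ.z≤n)))
  split : tailSum a zero * y zero + a′ · y′ ≡ a · y
  split = begin
    tailSum a zero * y zero + a′ · y′
      ≡⟨ cong₂ (λ F u → F * y zero + u) (tailSum-zero a) (·-subtract-constant a′ (λ l → y (suc l)) (y zero)) ⟩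
    (a zero + sumℚ a′) * y zero + (a′ · (λ l → y (suc l)) - sumℚ a′ * y zero)
      ≡⟨ solve 4 (λ a₀ A y₀ u → (a₀ :+ A) :* y₀ :+ (u :- A :* y₀) := a₀ :* y₀ :+ u) refl (a zero) (sumℚ a′) (y zero) _ ⟩
    a · y ∎

Chamber-scale : ∀ {n} {y : Fin n → ℚ} {s} → 0ℚ ℚ.< s → Chamber y → Chamber (λ l → s * y l)
Chamber-scale {s = s} 0<s (positive , increasing) =
  (λ l → *-pos 0<s (positive l)) , (λ i j i<j → QP.*-monoʳ-<-pos s {{ℚ.positive 0<s}} (increasing i j i<j))

chamber-section-nonempty : ∀ {m} (a : Fin (suc m) → ℚ) → (∀ k → 1ℚ ℚ.≤ tailSum a k) →
  ∀ {α} → 0ℚ ℚ.< α → ∃[ y ] Chamber y × a · y ≡ α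
chamber-section-nonempty {m} a F≥1 {α} 0<α = (λ l → s * y₀ l) , Chamber-scale 0<s y₀-chamber , a·y≡α
  where
  y₀ : Fin (suc m) → ℚ
  y₀ l = 2^ toℕ l
  y₀-chamber : Chamber y₀
  y₀-chamber = (λ l → 2^-pos (toℕ l)) , (λ i j i<j → 2^-mono-< i<j)
  0<f₀ : 0ℚ ℚ.< a · y₀
  0<f₀ = QP.<-≤-trans (2^-pos (toℕ (F.fromℕ m))) (last≤· a y₀ F≥1 (Chamber⇒Monotone y₀-chamber) (QP.<⇒≤ (2^-pos 0)))
  instance
    f₀-nonZero : ℚ.NonZero (a · y₀)
    f₀-nonZero = QP.pos⇒nonZero (a · y₀) {{ℚ.positive 0<f₀}}
  s : ℚ
  s = α * 1/ (a · y₀)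
  0<s : 0ℚ ℚ.< s
  0<s = *-pos 0<α (QP.positive⁻¹ _ {{QP.1/pos⇒pos (a · y₀) {{ℚ.positive 0<f₀}}}})
  a·y≡α : a · (λ l → s * y₀ l) ≡ α
  a·y≡α = begin
    a · (λ l → s * y₀ l)              ≡⟨ ·-scale a y₀ s ⟩
    α * 1/ (a · y₀) * (a · y₀)        ≡⟨ QP.*-assoc α _ (a · y₀) ⟩
    α * (1/ (a · y₀) * (a · y₀))      ≡⟨ cong (α *_) (QP.*-inverseˡ (a · y₀)) ⟩
    α * 1ℚ                            ≡⟨ QP.*-identityʳ α ⟩
    α                                 ∎

-- y = μ y₀ + ν 𝟙[ i ≤ · ] with ν > B: the lift by ν changes a · y by ν Fᵢ ≤ 0, which the
-- factor μ = (α − ν Fᵢ) / α ≥ 1 compensates.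
chamber-section-unbounded : ∀ {m} (a : Fin (suc m) → ℚ) (i : Fin (suc m)) → tailSum a i ℚ.≤ 0ℚ →
  ∀ {α} → 0ℚ ℚ.< α → ∀ {y₀} → Chamber y₀ → a · y₀ ≡ α →
  ∀ B → ∃[ y ] Chamber y × a · y ≡ α × B ℚ.< y (F.fromℕ m)
chamber-section-unbounded {m} a i Fᵢ≤0 {α} 0<α {y₀} (y₀-positive , y₀-increasing) a·y₀≡α B =
  y , (y-positive , y-increasing) , a·y≡α , B<y-last
  where
  instance
    α-nonZero : ℚ.NonZero α
    α-nonZero = QP.pos⇒nonZero α {{ℚ.positive 0<α}}
  0<1 : 0ℚ ℚ.< 1ℚ
  0<1 = toWitness {a? = 0ℚ QP.<? 1ℚ} tt
  ν : ℚ
  ν = ∣ B ∣ + 1ℚ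
  B<ν : B ℚ.< ν
  B<ν = QP.≤-<-trans (≤∣∣ B) (subst (ℚ._< ν) (QP.+-identityʳ ∣ B ∣) (QP.+-monoʳ-< ∣ B ∣ 0<1))
  0<ν : 0ℚ ℚ.< ν
  0<ν = QP.+-mono-≤-< (QP.0≤∣p∣ B) 0<1
  νFᵢ≤0 : ν * tailSum a i ℚ.≤ 0ℚ
  νFᵢ≤0 = subst (ν * tailSum a i ℚ.≤_) (QP.*-zeroʳ ν) (QP.*-monoˡ-≤-nonNeg ν {{ℚ.nonNegative (QP.<⇒≤ 0<ν)}} Fᵢ≤0)
  α≤α-νFᵢ : α ℚ.≤ α - ν * tailSum a i
  α≤α-νFᵢ = subst (ℚ._≤ α - ν * tailSum a i) (QP.+-identityʳ α) (QP.+-monoʳ-≤ α (QP.neg-antimono-≤ νFᵢ≤0))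
  μ : ℚ
  μ = (α - ν * tailSum a i) * 1/ α
  0<μ : 0ℚ ℚ.< μ
  0<μ = *-pos (QP.<-≤-trans 0<α α≤α-νFᵢ) (QP.positive⁻¹ _ {{QP.1/pos⇒pos α {{ℚ.positive 0<α}}}})
  y : Fin (suc m) → ℚ
  y l = μ * y₀ l + ν * 𝟙[ i ≤ l ]
  0≤ν𝟙 : ∀ l → 0ℚ ℚ.≤ ν * 𝟙[ i ≤ l ]
  0≤ν𝟙 l with i FP.≤? l
  ... | yes _ = QP.<⇒≤ (subst (0ℚ ℚ.<_) (sym (QP.*-identityʳ ν)) 0<ν)
  ... | no _  = QP.≤-reflexive (sym (QP.*-zeroʳ ν))
  y-positive : ∀ l → 0ℚ ℚ.< y l
  y-positive l = subst (ℚ._< y l) (QP.+-identityʳ 0ℚ) (QP.+-mono-<-≤ (*-pos 0<μ (y₀-positive l)) (0≤ν𝟙 l))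
  y-increasing : ∀ l l′ → l F.< l′ → y l ℚ.< y l′
  y-increasing l l′ l<l′ = QP.+-mono-<-≤ (QP.*-monoʳ-<-pos μ {{ℚ.positive 0<μ}} (y₀-increasing l l′ l<l′))
    (QP.*-monoˡ-≤-nonNeg ν {{ℚ.nonNegative (QP.<⇒≤ 0<ν)}} (𝟙-mono i (ℕP.<⇒≤ l<l′)))
  a·y≡α : a · y ≡ α
  a·y≡α = begin
    a · y                                                      ≡⟨ ·-lincomb a y₀ (λ l → 𝟙[ i ≤ l ]) μ ν ⟩
    μ * (a · y₀) + ν * (a · (λ l → 𝟙[ i ≤ l ]))                ≡⟨ cong₂ (λ u F → μ * u + ν * F) a·y₀≡α (sumℚ-cong (λ l → QP.*-comm (a l) 𝟙[ i ≤ l ])) ⟩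
    (α - ν * tailSum a i) * 1/ α * α + ν * tailSum a i         ≡⟨ cong (_+ ν * tailSum a i) (QP.*-assoc (α - ν * tailSum a i) (1/ α) α) ⟩
    (α - ν * tailSum a i) * (1/ α * α) + ν * tailSum a i       ≡⟨ cong (λ u → (α - ν * tailSum a i) * u + ν * tailSum a i) (QP.*-inverseˡ α) ⟩
    (α - ν * tailSum a i) * 1ℚ + ν * tailSum a i               ≡⟨ solve 2 (λ α νF → (α :- νF) :* con 1ℚ :+ νF := α) refl α (ν * tailSum a i) ⟩
    α                                                          ∎
  B<y-last : B ℚ.< y (F.fromℕ m)
  B<y-last = QP.<-≤-trans B<ν (subst₂ ℚ._≤_ (QP.+-identityˡ ν) ν≡ν𝟙
    (QP.+-monoˡ-≤ ν (QP.<⇒≤ (*-pos 0<μ (y₀-positive (F.fromℕ m))))))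
    where
    ν≡ν𝟙 : μ * y₀ (F.fromℕ m) + ν ≡ y (F.fromℕ m)
    ν≡ν𝟙 = cong (λ u → μ * y₀ (F.fromℕ m) + u) (sym (trans (cong (ν *_) (𝟙-≤ (FP.≤fromℕ i))) (QP.*-identityʳ ν)))

argmax-from : ∀ {n} (g : Fin n → ℕ) (k : Fin n) → ∃[ r ] k F.≤ r × (∀ l → k F.≤ l → g l ℕ.≤ g r)
argmax-from {suc n} g (suc k) with argmax-from (λ l → g (suc l)) k
... | r , k≤r , max = suc r , ℕ.s≤s k≤r , λ { zero () ; (suc l) k<l → max l (ℕ.s≤s⁻¹ k<l) }
argmax-from {suc zero} g zero = zero , ℕ.z≤n , λ { zero _ → ℕP.≤-refl }
argmax-from {suc (suc n)} g zero with argmax-from (λ l → g (suc l)) zero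
... | r , _ , max with g zero ℕP.≤? g (suc r)
...   | yes g₀≤gr = suc r , ℕ.z≤n , λ { zero _ → g₀≤gr ; (suc l) _ → max l ℕ.z≤n }
...   | no g₀≰gr  = zero , ℕ.z≤n , λ { zero _ → ℕP.≤-refl ; (suc l) _ → ℕP.≤-trans (max l ℕ.z≤n) (ℕP.<⇒≤ (ℕP.≰⇒> g₀≰gr)) }

module SignedPermutation {n} (ω : Permutation′ n) (ε : SignVec n) where

  -- Region ω ε x unfolds to Chamber (coords x).
  coords : Vecℚ n → Fin n → ℚ
  coords x l = signed (ε l) (x (ω ⟨$⟩ʳ l))

  point : (Fin n → ℚ) → Vecℚ n
  point y k = signed (ε (ω ⟨$⟩ˡ k)) (y (ω ⟨$⟩ˡ k))

  coords-point : ∀ y l → coords (point y) l ≡ y l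
  coords-point y l = trans (cong (λ l′ → signed (ε l) (signed (ε l′) (y l′))) (inverseˡ ω)) (signed-involutive (ε l) (y l))

  ·-coords : ∀ w x → w · x ≡ coords w · coords x
  ·-coords w x = trans (sumℚ-permute (λ k → w k * x k) ω)
    (sumℚ-cong (λ l → sym (signed-*-signed (ε l) (w (ω ⟨$⟩ʳ l)) (x (ω ⟨$⟩ʳ l)))))

  Region-point : ∀ {y} → Chamber y → Region ω ε (point y)
  Region-point {y} (positive , increasing) =
    (λ l → subst (0ℚ ℚ.<_) (sym (coords-point y l)) (positive l)) ,
    (λ i j i<j → subst₂ ℚ._<_ (sym (coords-point y i)) (sym (coords-point y j)) (increasing i j i<j))

  ∣x∣≡∣coords∣ : ∀ x k → ∣ x k ∣ ≡ ∣ coords x (ω ⟨$⟩ˡ k) ∣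
  ∣x∣≡∣coords∣ x k = trans (cong (λ k′ → ∣ x k′ ∣) (sym (inverseʳ ω))) (sym (∣signed∣ (ε (ω ⟨$⟩ˡ k)) _))

  weights : Fin n → ℚ
  weights = coords (vPow2 n)

  σ : Fin n → ℚ
  σ l = signed (ε l) 1ℚ

  -- ε_r F_k in binary: its digit at 2^e is ε_r ε_l [k ≤ l] for l = ω⁻¹(e).
  tailDigits : Fin n → Fin n → Fin n → ℚ
  tailDigits r k e = σ r * (𝟙[ k ≤ ω ⟨$⟩ˡ e ] * σ (ω ⟨$⟩ˡ e))

  signed-tailSum : ∀ r k → signed (ε r) (tailSum weights k) ≡ binValue (tailDigits r k)
  signed-tailSum r k = begin
    signed (ε r) (tailSum weights k)                              ≡⟨ signed≡* (ε r) (tailSum weights k) ⟩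
    σ r * tailSum weights k                                       ≡⟨ *-distribˡ-sumℚ (σ r) (λ l → 𝟙[ k ≤ l ] * weights l) ⟩
    sumℚ (λ l → σ r * (𝟙[ k ≤ l ] * weights l))                   ≡⟨ sumℚ-permute (λ l → σ r * (𝟙[ k ≤ l ] * weights l)) (Perm.flip ω) ⟩
    sumℚ (λ e → σ r * (𝟙[ k ≤ ω ⟨$⟩ˡ e ] * weights (ω ⟨$⟩ˡ e)))  ≡⟨ sumℚ-cong term ⟩
    binValue (tailDigits r k)                                     ∎
    where
    term : ∀ e → σ r * (𝟙[ k ≤ ω ⟨$⟩ˡ e ] * weights (ω ⟨$⟩ˡ e)) ≡ vPow2 n e * tailDigits r k e
    term e = begin
      σ r * (𝟙[ k ≤ l ] * signed (ε l) (vPow2 n (ω ⟨$⟩ʳ l)))  ≡⟨ cong (λ e′ → σ r * (𝟙[ k ≤ l ] * signed (ε l) (vPow2 n e′))) (inverseʳ ω) ⟩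
      σ r * (𝟙[ k ≤ l ] * signed (ε l) (vPow2 n e))            ≡⟨ cong (λ u → σ r * (𝟙[ k ≤ l ] * u)) (signed≡* (ε l) (vPow2 n e)) ⟩
      σ r * (𝟙[ k ≤ l ] * (σ l * vPow2 n e))                   ≡⟨ solve 4 (λ a b c v → a :* (b :* (c :* v)) := v :* (a :* (b :* c))) refl (σ r) 𝟙[ k ≤ l ] (σ l) (vPow2 n e) ⟩
      vPow2 n e * tailDigits r k e                             ∎
      where
      l : Fin n
      l = ω ⟨$⟩ˡ e

  tailSum-sign : ∀ k r → k F.≤ r → (∀ l → k F.≤ l → toℕ (ω ⟨$⟩ʳ l) ℕ.≤ toℕ (ω ⟨$⟩ʳ r)) →
    1ℚ ℚ.≤ signed (ε r) (tailSum weights k)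
  tailSum-sign k r k≤r dominated =
    subst (1ℚ ℚ.≤_) (sym (signed-tailSum r k)) (binValue-top (tailDigits r k) (ω ⟨$⟩ʳ r) digits top above)
    where
    digits : ∀ e → SignedDigit (tailDigits r k e)
    digits e = SignedDigit-* (±1ᵈ (ε r)) (SignedDigit-* (𝟙-digit k (ω ⟨$⟩ˡ e)) (±1ᵈ (ε (ω ⟨$⟩ˡ e))))
    top : tailDigits r k (ω ⟨$⟩ʳ r) ≡ 1ℚ
    top = begin
      σ r * (𝟙[ k ≤ ω ⟨$⟩ˡ (ω ⟨$⟩ʳ r) ] * σ (ω ⟨$⟩ˡ (ω ⟨$⟩ʳ r)))  ≡⟨ cong (λ l → σ r * (𝟙[ k ≤ l ] * σ l)) (inverseˡ ω) ⟩
      σ r * (𝟙[ k ≤ r ] * σ r)                                  ≡⟨ cong (λ u → σ r * (u * σ r)) (𝟙-≤ k≤r) ⟩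
      σ r * (1ℚ * σ r)                                          ≡⟨ cong (σ r *_) (QP.*-identityˡ (σ r)) ⟩
      σ r * σ r                                                 ≡⟨ signed-*-signed (ε r) 1ℚ 1ℚ ⟩
      1ℚ                                                        ∎
    above : ∀ e → ω ⟨$⟩ʳ r F.< e → tailDigits r k e ≡ 0ℚ
    above e ωr<e = begin
      σ r * (𝟙[ k ≤ ω ⟨$⟩ˡ e ] * σ (ω ⟨$⟩ˡ e))  ≡⟨ cong (λ u → σ r * (u * σ (ω ⟨$⟩ˡ e))) (𝟙-≰ k≰ω⁻¹e) ⟩
      σ r * (0ℚ * σ (ω ⟨$⟩ˡ e))                 ≡⟨ cong (σ r *_) (QP.*-zeroˡ (σ (ω ⟨$⟩ˡ e))) ⟩
      σ r * 0ℚ                                  ≡⟨ QP.*-zeroʳ (σ r) ⟩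
      0ℚ                                        ∎
      where
      k≰ω⁻¹e : ¬ k F.≤ ω ⟨$⟩ˡ e
      k≰ω⁻¹e k≤ω⁻¹e = ℕP.<⇒≱ ωr<e (subst (λ e′ → toℕ e′ ℕ.≤ toℕ (ω ⟨$⟩ʳ r)) (inverseʳ ω) (dominated (ω ⟨$⟩ˡ e) k≤ω⁻¹e))

  ω-injective : ∀ {i j} → toℕ (ω ⟨$⟩ʳ i) ≡ toℕ (ω ⟨$⟩ʳ j) → i ≡ j
  ω-injective {i} {j} ωi≡ωj = trans (sym (inverseˡ ω)) (trans (cong (ω ⟨$⟩ˡ_) (FP.toℕ-injective ωi≡ωj)) (inverseˡ ω))

  unbarred⇒tailSum≥1 : AllRLMaxUnbarred ω ε → ∀ k → 1ℚ ℚ.≤ tailSum weights k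
  unbarred⇒tailSum≥1 unbarred k with argmax-from (λ l → toℕ (ω ⟨$⟩ʳ l)) k
  ... | r , k≤r , dominated =
    subst (λ s → 1ℚ ℚ.≤ signed s (tailSum weights k)) (unbarred r r-RLMax) (tailSum-sign k r k≤r dominated)
    where
    r-RLMax : RLMax ω r
    r-RLMax j r<j = ℕP.≤∧≢⇒< (dominated j (ℕP.≤-trans k≤r (ℕP.<⇒≤ r<j)))
      (λ ωj≡ωr → ℕP.<-irrefl (cong toℕ (sym (ω-injective ωj≡ωr))) r<j)

  barred⇒tailSum≤0 : ∀ i → RLMax ω i → ε i ≡ Sign.- → tailSum weights i ℚ.≤ 0ℚ
  barred⇒tailSum≤0 i i-RLMax εi≡- = QP.≤-trans Fᵢ≤-1 (toWitness {a? = - 1ℚ QP.≤? 0ℚ} tt)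
    where
    dominated : ∀ l → i F.≤ l → toℕ (ω ⟨$⟩ʳ l) ℕ.≤ toℕ (ω ⟨$⟩ʳ i)
    dominated l i≤l with ℕP.m≤n⇒m<n∨m≡n i≤l
    ... | inj₁ i<l = ℕP.<⇒≤ (i-RLMax l i<l)
    ... | inj₂ i≡l = ℕP.≤-reflexive (cong (λ j → toℕ (ω ⟨$⟩ʳ j)) (sym (FP.toℕ-injective i≡l)))
    1≤-Fᵢ : 1ℚ ℚ.≤ - tailSum weights i
    1≤-Fᵢ = subst (λ s → 1ℚ ℚ.≤ signed s (tailSum weights i)) εi≡- (tailSum-sign i i ℕP.≤-refl dominated)
    Fᵢ≤-1 : tailSum weights i ℚ.≤ - 1ℚ
    Fᵢ≤-1 = subst (ℚ._≤ - 1ℚ) (⁻¹-involutive (tailSum weights i)) (QP.neg-antimono-≤ 1≤-Fᵢ)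

0<vPow2·vPow2 : ∀ m → 0ℚ ℚ.< vPow2 (suc m) · vPow2 (suc m)
0<vPow2·vPow2 m = QP.+-mono-<-≤ (toWitness {a? = 0ℚ QP.<? 1ℚ * 1ℚ} tt)
  (sumℚ-nonNeg {m} (λ i → 2^ suc (toℕ i) * 2^ suc (toℕ i)) (λ i → QP.<⇒≤ (*-pos (2^-pos (suc (toℕ i))) (2^-pos (suc (toℕ i))))))

module RegionSection {m} (ω : Permutation′ (suc m)) (ε : SignVec (suc m)) where

  open SignedPermutation ω ε

  v : Vecℚ (suc m)
  v = vPow2 (suc m)

  0<α : 0ℚ ℚ.< v · v
  0<α = 0<vPow2·vPow2 m

  H-coords : ∀ x → H v x → weights · coords x ≡ v · v
  H-coords x x∈H = trans (sym (·-coords v x)) x∈H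

  H-point : ∀ y → weights · y ≡ v · v → H v (point y)
  H-point y w·y≡α = trans (·-coords v (point y)) (trans (sumℚ-cong (λ l → cong (weights l *_) (coords-point y l))) w·y≡α)

  nonempty-bounded : AllRLMaxUnbarred ω ε → Nonempty (Region ω ε ∩ H v) × Bounded (Region ω ε ∩ H v)
  nonempty-bounded unbarred =
    let y , y-chamber , w·y≡α = chamber-section-nonempty weights (unbarred⇒tailSum≥1 unbarred) 0<α
    in (point y , Region-point y-chamber , H-point y w·y≡α) , v · v , bound
    where
    bound : ∀ x → (Region ω ε ∩ H v) x → ∀ k → ∣ x k ∣ ℚ.≤ v · v
    bound x (x∈R , x∈H) k = subst₂ ℚ._≤_ (sym ∣xₖ∣≡yₗ) (H-coords x x∈H)
      (QP.≤-trans (Chamber⇒Monotone x∈R (FP.≤fromℕ l))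
        (last≤· weights (coords x) (unbarred⇒tailSum≥1 unbarred) (Chamber⇒Monotone x∈R) (QP.<⇒≤ (proj₁ x∈R zero))))
      where
      l : Fin (suc m)
      l = ω ⟨$⟩ˡ k
      ∣xₖ∣≡yₗ : ∣ x k ∣ ≡ coords x l
      ∣xₖ∣≡yₗ = trans (∣x∣≡∣coords∣ x k) (QP.0≤p⇒∣p∣≡p (QP.<⇒≤ (proj₁ x∈R l)))

  barred⇒unbounded : ∀ {x₀} → (Region ω ε ∩ H v) x₀ → ∀ i → RLMax ω i → ε i ≡ Sign.- →
    ∀ B → ∃[ x ] (Region ω ε ∩ H v) x × B ℚ.< ∣ x (ω ⟨$⟩ʳ F.fromℕ m) ∣
  barred⇒unbounded {x₀} (x₀∈R , x₀∈H) i i-RLMax εi≡- B =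
    let y , y-chamber , w·y≡α , B<yₘ = chamber-section-unbounded weights i (barred⇒tailSum≤0 i i-RLMax εi≡-) 0<α
                                        x₀∈R (H-coords x₀ x₀∈H) B
    in point y , (Region-point y-chamber , H-point y w·y≡α) , subst (B ℚ.<_) (sym (∣point-last∣ y-chamber)) B<yₘ
    where
    ∣point-last∣ : ∀ {y} → Chamber y → ∣ point y (ω ⟨$⟩ʳ F.fromℕ m) ∣ ≡ y (F.fromℕ m)
    ∣point-last∣ {y} y-chamber = begin
      ∣ point y (ω ⟨$⟩ʳ F.fromℕ m) ∣    ≡⟨ ∣signed∣ (ε (F.fromℕ m)) _ ⟨
      ∣ coords (point y) (F.fromℕ m) ∣  ≡⟨ cong ∣_∣ (coords-point y (F.fromℕ m)) ⟩
      ∣ y (F.fromℕ m) ∣                 ≡⟨ QP.0≤p⇒∣p∣≡p (QP.<⇒≤ (proj₁ y-chamber (F.fromℕ m))) ⟩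
      y (F.fromℕ m)                     ∎

  nonempty-bounded⇒unbarred : Nonempty (Region ω ε ∩ H v) × Bounded (Region ω ε ∩ H v) → AllRLMaxUnbarred ω ε
  nonempty-bounded⇒unbarred ((x₀ , x₀∈) , B , bound) i i-RLMax with ε i in εi≡
  ... | Sign.+ = refl
  ... | Sign.- =
    let x , x∈ , B<∣x∣ = barred⇒unbounded {x₀} x₀∈ i i-RLMax εi≡ B
    in ⊥-elim (QP.<-irrefl refl (QP.<-≤-trans B<∣x∣ (bound x x∈ (ω ⟨$⟩ʳ F.fromℕ m))))

proposition7p2 : (n : ℕ) → 1 ≤ n →
    GenericB n (H (vPow2 n)) ×
    ((ω : Permutation′ n) (ε : SignVec n) →
      (Nonempty (Region ω ε ∩ H (vPow2 n)) × Bounded (Region ω ε ∩ H (vPow2 n)))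
        ⇔ AllRLMaxUnbarred ω ε)
proposition7p2 (suc m) _ = generic , λ ω ε → mk⇔ (nonempty-bounded⇒unbarred ω ε) (nonempty-bounded ω ε)
  where
  open RegionSection using (nonempty-bounded; nonempty-bounded⇒unbarred)
  α≢0 : vPow2 (suc m) · vPow2 (suc m) ≢ 0ℚ
  α≢0 α≡0 = QP.<-irrefl (sym α≡0) (0<vPow2·vPow2 m)
  generic : GenericB (suc m) (H (vPow2 (suc m)))
  generic hs = Dim-section (Flat-isLinearSubspace hs) (vPow2 (suc m)) α≢0 (Flat-nondegenerate hs)
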